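{- Let $L=(T,V,E)$ be a simple link stream with durations and let $C=(X,[x,y])$ be a maximal clique of $L$ with $|X|\ge 2$. Then there exists a link $(b,e,u,v)\in E$ with $u,v\in X$ and $b=x$.
   Context: A link stream with durations is a triplet $L=(T,V,E)$ where $T$ is a time interval, $V$ a finite set of nodes and $E\subseteq T\times T\times V\times V$ a finite set of links such that every link $(b,e,u,v)\in E$ satisfies $e\ge b$; links $(b,e,u,v)$ and $(b,e,v,u)$ are not distinguished. It is simple if for all $(b,e,u,v)\in E$ we have $u\neq v$, and for any two distinct links $(b,e,u,v),(b',e',u,v)\in E$ on the same pair of nodes, $[b,e]\cap[b',e']=\emptyset$. A clique of $L$ is a pair $C=(X,[x,y])$ with $X\subseteq V$ and $[x,y]\subseteq T$ such that for every pair $\{u,v\}\subseteq X$ of distinct nodes there is a link $(b,e,u,v)\in E$ with $[x,y]\subseteq[b,e]$. A clique $C=(X,[x,y])$ is maximal if there is no clique $C'=(X',[x',y'])\neq C$ with $X\subseteq X'$ and $[x,y]\subseteq[x',y']$. -}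

module Defs where

open import Level using (Level)
open import Data.Nat using (ℕ)
open import Data.Fin using (Fin)
open import Data.Fin.Subset using (Subset; _∈_; _⊆_)
open import Data.List using (List)
open import Data.List.Membership.Propositional renaming (_∈_ to _∈ₗ_)
open import Data.Product using (Σ; _×_; _,_; ∃; ∃-syntax)
open import Data.Sum using (_⊎_)
open import Relation.Binary.Core using (Rel)
open import Relation.Binary.Structures using (IsTotalOrder)
open import Relation.Binary.PropositionalEquality using (_≡_)
open import Relation.Nullary using (¬_)

-- Time is an arbitrary totally ordered type (e.g. ℝ); all definitions are
-- parametrised by it.  Nodes are V = Fin n (a finite set).
module LinkStreams {t ℓ : Level} (Time : Set t) (_≤_ : Rel Time ℓ)
                   (isTO : IsTotalOrder _≡_ _≤_) where

  _∈[_,_] : Time → Time → Time → Set ℓ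
  s ∈[ x , y ] = (x ≤ s) × (s ≤ y)

  -- [x,y] ⊆ [x',y'] as sets of time instants (not merely endpoint comparison)
  _⊆ᵢ_ : (Time × Time) → (Time × Time) → Set (t Level.⊔ ℓ)
  (x , y) ⊆ᵢ (x' , y') = ∀ s → s ∈[ x , y ] → s ∈[ x' , y' ]

  record TimeInterval : Set (Level.suc (t Level.⊔ ℓ)) where
    field
      inT    : Time → Set (t Level.⊔ ℓ)
      convex : ∀ {a b s} → inT a → inT b → a ≤ s → s ≤ b → inT s

  record Link (n : ℕ) : Set t where
    constructor link
    field
      b e : Time
      u v : Fin n

  record LinkStream (n : ℕ) : Set (Level.suc (t Level.⊔ ℓ)) where
    field
      T      : TimeInterval
      E      : List (Link n)
      linkOK : ∀ {l} → l ∈ₗ E →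
               TimeInterval.inT T (Link.b l) × TimeInterval.inT T (Link.e l)
               × (Link.b l ≤ Link.e l)

  module _ {n : ℕ} (L : LinkStream n) where
    open LinkStream L
    open TimeInterval T

    OnPair : Link n → Fin n → Fin n → Set
    OnPair l u v = (Link.u l ≡ u × Link.v l ≡ v) ⊎ (Link.u l ≡ v × Link.v l ≡ u)

    Simple : Set (t Level.⊔ ℓ)
    Simple = (∀ {l} → l ∈ₗ E → ¬ (Link.u l ≡ Link.v l))
           × (∀ {l l'} → l ∈ₗ E → l' ∈ₗ E → ¬ (l ≡ l')
              → OnPair l' (Link.u l) (Link.v l)
              → ¬ (∃[ s ] (s ∈[ Link.b l , Link.e l ] × s ∈[ Link.b l' , Link.e l' ])))

    IsClique : Subset n → Time → Time → Set (t Level.⊔ ℓ)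
    IsClique X x y =
      (x ≤ y) × (∀ s → s ∈[ x , y ] → inT s)
      × (∀ u v → u ∈ X → v ∈ X → ¬ (u ≡ v) →
           ∃[ l ] (l ∈ₗ E × OnPair l u v × ((x , y) ⊆ᵢ (Link.b l , Link.e l))))

    IsMaximalClique : Subset n → Time → Time → Set (t Level.⊔ ℓ)
    IsMaximalClique X x y =
      IsClique X x y
      × (∀ X' x' y' → IsClique X' x' y' → X ⊆ X' → (x , y) ⊆ᵢ (x' , y')
           → (X' ≡ X) × (x' ≡ x) × (y' ≡ y))

module Submission where

-- For each pair u ≠ v of X the clique property supplies a link on
-- {u,v} alive throughout [x,y]; in particular it starts at or before x.
-- Among these finitely many links take one whose start M is latest
-- (Data.List.Extrema.argmax over all pairs of nodes).  Every pair of X then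
-- has a link alive on [M,y], and M lies in T because it is the start of a
-- link, so (X,[M,y]) is again a clique containing (X,[x,y]).  Maximality
-- forces M = x, and the link realising M is the one we want.

open import Defs
open import Level using (Level; _⊔_)
open import Data.Nat using (ℕ; _≤_; s≤s)
open import Data.Nat.Properties using (1+n≰n)
open import Data.Fin using (Fin; zero; suc)
open import Data.Fin.Properties using (_≟_; suc-injective)
open import Data.Fin.Subset using (Subset; _∈_; ∣_∣; inside; outside; Nonempty)
open import Data.Fin.Subset.Properties using (_∈?_; nonempty?; Empty-unique; ∣⊥∣≡0)
open import Data.Vec using (_∷_; here; there)
open import Data.List using (allFin; cartesianProduct)
open import Data.List.Membership.Propositional renaming (_∈_ to _∈ₗ_)
open import Data.List.Membership.Propositional.Properties
  using (∈-allFin; ∈-cartesianProduct⁺)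
open import Data.List.Relation.Unary.All using (lookup)
open import Data.Product using (_×_; ∃-syntax; _,_; proj₁; proj₂)
open import Data.Sum using (inj₁; inj₂)
open import Relation.Binary.Core using (Rel)
open import Relation.Binary.Bundles using (TotalOrder)
open import Relation.Binary.Structures using (IsTotalOrder)
open import Relation.Binary.PropositionalEquality using (_≡_; refl; trans; subst; cong)
open import Relation.Nullary using (yes; no; ¬_; contradiction)
import Data.List.Extrema

size≥1⇒nonempty : ∀ {m} (p : Subset m) → 1 ≤ ∣ p ∣ → Nonempty p
size≥1⇒nonempty {m} p 1≤∣p∣ with nonempty? p
... | yes ne   = ne
... | no empty =
  contradiction (subst (1 ≤_) (trans (cong ∣_∣ (Empty-unique empty)) (∣⊥∣≡0 m)) 1≤∣p∣) 1+n≰n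

size≥2⇒twoElements : ∀ {m} (p : Subset m) → 2 ≤ ∣ p ∣ →
  ∃[ u ] ∃[ v ] (u ∈ p × v ∈ p × ¬ (u ≡ v))
size≥2⇒twoElements (inside ∷ p) (s≤s 1≤∣p∣) with size≥1⇒nonempty p 1≤∣p∣
... | w , w∈p = zero , suc w , here , there w∈p , λ ()
size≥2⇒twoElements (outside ∷ p) 2≤∣p∣ with size≥2⇒twoElements p 2≤∣p∣
... | u , v , u∈p , v∈p , u≢v =
  suc u , suc v , there u∈p , there v∈p , λ eq → u≢v (suc-injective eq)

module _ {t ℓ : Level} (Time : Set t) (_≼_ : Rel Time ℓ)
         (isTO : IsTotalOrder _≡_ _≼_) where
  open LinkStreams Time _≼_ isTO
  open IsTotalOrder isTO using () renaming (refl to ≼-refl; trans to ≼-trans)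

  timeOrder : TotalOrder t t ℓ
  timeOrder = record { Carrier = Time ; _≈_ = _≡_ ; _≤_ = _≼_ ; isTotalOrder = isTO }

  open Data.List.Extrema timeOrder using (argmax; f[xs]≤f[argmax])

  module _ {n : ℕ} (L : LinkStream n) where
    open LinkStream L
    open TimeInterval T

    Spans : Subset n → Time → Time → Link n → Set (t ⊔ ℓ)
    Spans X x y l = (l ∈ₗ E) × (Link.u l ∈ X) × (Link.v l ∈ X)
                  × ((x , y) ⊆ᵢ (Link.b l , Link.e l))

    onPair-endpoints : ∀ {X l u v} → OnPair L l u v → u ∈ X → v ∈ X →
      (Link.u l ∈ X) × (Link.v l ∈ X)
    onPair-endpoints (inj₁ (refl , refl)) u∈X v∈X = u∈X , v∈X
    onPair-endpoints (inj₂ (refl , refl)) u∈X v∈X = v∈X , u∈X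

    clique-extendLeft : ∀ {X x y x'} → IsClique L X x y → x' ≼ x → inT x' →
      (∀ u v → u ∈ X → v ∈ X → ¬ (u ≡ v) →
         ∃[ l ] ((l ∈ₗ E) × OnPair L l u v × (Link.b l ≼ x')
                 × ((x , y) ⊆ᵢ (Link.b l , Link.e l)))) →
      IsClique L X x' y
    clique-extendLeft {X} {x} {y} {x'} (x≼y , [x,y]⊆T , _) x'≼x x'∈T early =
      ≼-trans x'≼x x≼y , [x',y]⊆T , pairs
      where
      y∈T : inT y
      y∈T = [x,y]⊆T y (x≼y , ≼-refl)

      [x',y]⊆T : ∀ s → s ∈[ x' , y ] → inT s
      [x',y]⊆T s (x'≼s , s≼y) = convex x'∈T y∈T x'≼s s≼y

      pairs : ∀ u v → u ∈ X → v ∈ X → ¬ (u ≡ v) →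
        ∃[ l ] ((l ∈ₗ E) × OnPair L l u v × ((x' , y) ⊆ᵢ (Link.b l , Link.e l)))
      pairs u v u∈X v∈X u≢v with early u v u∈X v∈X u≢v
      ... | l , l∈E , onPair , b≼x' , [x,y]⊆l =
        l , l∈E , onPair , λ s (x'≼s , s≼y) →
          ≼-trans b≼x' x'≼s , ≼-trans s≼y (proj₂ ([x,y]⊆l y (x≼y , ≼-refl)))

    maximal-start : ∀ {X x y x'} → IsMaximalClique L X x y →
      IsClique L X x' y → x' ≼ x → x' ≡ x
    maximal-start (_ , maximal) clique' x'≼x =
      proj₁ (proj₂ (maximal _ _ _ clique' (λ u∈X → u∈X)
                      (λ s (x≼s , s≼y) → ≼-trans x'≼x x≼s , s≼y)))

    module LatestStart {X : Subset n} {x y : Time} (clique : IsClique L X x y)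
                       (u₀ v₀ : Fin n) (u₀∈X : u₀ ∈ X) (v₀∈X : v₀ ∈ X)
                       (u₀≢v₀ : ¬ (u₀ ≡ v₀)) where

      x≼y : x ≼ y
      x≼y = proj₁ clique

      witness : ∀ u v → u ∈ X → v ∈ X → ¬ (u ≡ v) →
        ∃[ l ] ((l ∈ₗ E) × OnPair L l u v × ((x , y) ⊆ᵢ (Link.b l , Link.e l)))
      witness = proj₂ (proj₂ clique)

      witness-spans : ∀ u v (u∈X : u ∈ X) (v∈X : v ∈ X) (u≢v : ¬ (u ≡ v)) → Spans X x y (proj₁ (witness u v u∈X v∈X u≢v))
      witness-spans u v u∈X v∈X u≢v with witness u v u∈X v∈X u≢v
      ... | l , l∈E , onPair , [x,y]⊆l =
        let (lu∈X , lv∈X) = onPair-endpoints {X} {l} onPair u∈X v∈X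
        in l∈E , lu∈X , lv∈X , [x,y]⊆l

      -- A link for every pair of nodes: the witness for pairs of distinct
      -- nodes of X, the witness for {u₀,v₀} otherwise.  All of them span [x,y].
      chosen : Fin n → Fin n → Link n
      chosen u v with u ∈? X | v ∈? X | u ≟ v
      ... | yes u∈X | yes v∈X | no u≢v = proj₁ (witness u v u∈X v∈X u≢v)
      ... | _       | _       | _      = proj₁ (witness u₀ v₀ u₀∈X v₀∈X u₀≢v₀)

      chosen-spans : ∀ u v → Spans X x y (chosen u v)
      chosen-spans u v with u ∈? X | v ∈? X | u ≟ v
      ... | yes u∈X | yes v∈X | no u≢v = witness-spans u v u∈X v∈X u≢v
      ... | yes _   | yes _   | yes _  = witness-spans u₀ v₀ u₀∈X v₀∈X u₀≢v₀
      ... | yes _   | no _    | _      = witness-spans u₀ v₀ u₀∈X v₀∈X u₀≢v₀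
      ... | no _    | _       | _      = witness-spans u₀ v₀ u₀∈X v₀∈X u₀≢v₀

      chosen-onPair : ∀ u v → u ∈ X → v ∈ X → ¬ (u ≡ v) → OnPair L (chosen u v) u v
      chosen-onPair u v u∈X v∈X u≢v with u ∈? X | v ∈? X | u ≟ v
      ... | yes u∈X' | yes v∈X' | no u≢v' = proj₁ (proj₂ (proj₂ (witness u v u∈X' v∈X' u≢v')))
      ... | yes _    | yes _    | yes u≡v = contradiction u≡v u≢v
      ... | yes _    | no v∉X   | _       = contradiction v∈X v∉X
      ... | no u∉X   | _        | _       = contradiction u∈X u∉X

      start : Fin n × Fin n → Time
      start (u , v) = Link.b (chosen u v)

      latestPair : Fin n × Fin n
      latestPair = argmax start (u₀ , v₀) (cartesianProduct (allFin n) (allFin n))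

      latest : Link n
      latest = chosen (proj₁ latestPair) (proj₂ latestPair)

      latest-spans : Spans X x y latest
      latest-spans = chosen-spans (proj₁ latestPair) (proj₂ latestPair)

      start≼latest : ∀ u v → Link.b (chosen u v) ≼ Link.b latest
      start≼latest u v =
        lookup (f[xs]≤f[argmax] (u₀ , v₀) (cartesianProduct (allFin n) (allFin n)))
               (∈-cartesianProduct⁺ (∈-allFin u) (∈-allFin v))

      latest≼x : Link.b latest ≼ x
      latest≼x = proj₁ (proj₂ (proj₂ (proj₂ latest-spans)) x (≼-refl , x≼y))

      latest-clique : IsClique L X (Link.b latest) y
      latest-clique = clique-extendLeft clique latest≼x latest∈T early
        where
        latest∈T : inT (Link.b latest)
        latest∈T = proj₁ (linkOK (proj₁ latest-spans))

        early : ∀ u v → u ∈ X → v ∈ X → ¬ (u ≡ v) →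
          ∃[ l ] ((l ∈ₗ E) × OnPair L l u v × (Link.b l ≼ Link.b latest)
                  × ((x , y) ⊆ᵢ (Link.b l , Link.e l)))
        early u v u∈X v∈X u≢v =
          let (l∈E , _ , _ , [x,y]⊆l) = chosen-spans u v
          in chosen u v , l∈E , chosen-onPair u v u∈X v∈X u≢v , start≼latest u v , [x,y]⊆l

mainTheorem3 : {t ℓ : Level} (Time : Set t) (_≼_ : Rel Time ℓ)
    (isTO : IsTotalOrder _≡_ _≼_) (n : ℕ)
    (L : LinkStreams.LinkStream Time _≼_ isTO n) →
    LinkStreams.Simple Time _≼_ isTO L →
    (X : Subset n) (x y : Time) →
    LinkStreams.IsMaximalClique Time _≼_ isTO L X x y →
    2 ≤ ∣ X ∣ →
    ∃[ l ] ((l ∈ₗ LinkStreams.LinkStream.E L)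
      × (LinkStreams.Link.u l ∈ X) × (LinkStreams.Link.v l ∈ X)
      × (LinkStreams.Link.b l ≡ x))
mainTheorem3 Time _≼_ isTO n L _ X x y maximal 2≤∣X∣
  with size≥2⇒twoElements X 2≤∣X∣
... | u₀ , v₀ , u₀∈X , v₀∈X , u₀≢v₀ =
  let (l∈E , lu∈X , lv∈X , _) = latest-spans
  in latest , l∈E , lu∈X , lv∈X ,
     maximal-start Time _≼_ isTO L maximal latest-clique latest≼x
  where open LatestStart Time _≼_ isTO L (proj₁ maximal) u₀ v₀ u₀∈X v₀∈X u₀≢v₀
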